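{- Let $H$ be a graph with $V(H)=\{v_1,\ldots,v_h\}$, let $w:V(H)\setminus\{v_1\}\to\mathbb{R}$ be an arbitrary weight function and $\theta>0$ a real number. Let $\hat J$ be a graph from the family \[ \operatorname{argmin}_{J\subseteq H:\, v_1\in J}\Big(\sum_{u\in V(J)\setminus\{v_1\}}(1+w(u))-e(J)\cdot\theta\Big). \] Moreover, let $v_k$ be a vertex of $\hat J$ and let $\tilde J$ be a graph from the family \[ \operatorname{argmin}_{J\subseteq H\setminus\{v_1,\ldots,v_{k-1}\}:\, v_k\in J}\Big(\sum_{u\in V(J)\setminus\{v_k\}}(1+w(u))-e(J)\cdot\theta\Big). \] Then $\tilde J\cap\hat J$ is also contained in the second family. In particular, for any two graphs $J',J''$ from the first family, $J'\cap J''$ also belongs to the first family.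
   Context: Minimizations are over all (not necessarily induced) subgraphs $J$ of the indicated graph containing the indicated vertex. $H\setminus U$ denotes the graph obtained from $H$ by deleting the vertices in $U$ and all incident edges. For subgraphs $J_1,J_2$ of $H$, $J_1\cap J_2$ is the subgraph with vertex set $V(J_1)\cap V(J_2)$ and edge set $E(J_1)\cap E(J_2)$. -}

module Defs where

open import Level using (Level; _⊔_)
open import Data.Nat as ℕ using (ℕ; zero; suc)
open import Data.Bool using (Bool; true; false; _∧_; not; T; if_then_else_)
open import Data.Vec using (lookup)
open import Data.Bool.Properties using (T-∧)
open import Data.Fin using (Fin; toℕ; _<?_; _≟_)
open import Data.Fin.Subset using (Subset; _∈_; _∉_; _∩_)
open import Data.Fin.Subset.Properties using (x∈p∩q⁺; x∈p∩q⁻)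
open import Data.List using (List; foldr; allFin)
open import Data.Product using (_×_; _,_; proj₁; proj₂)
open import Relation.Binary.PropositionalEquality using (_≡_; cong₂)
open import Relation.Nullary using (¬_; does)
open import Function.Bundles using (Equivalence)
open import Algebra.Bundles using (CommutativeRing)
open import Relation.Binary.Structures using (IsTotalOrder)

-- Ordered commutative rings (ℝ is an instance).  The stdlib has no reals,
-- so the statement is made for an arbitrary totally ordered commutative ring.

record OrderedCommRing (c ℓ₁ ℓ₂ : Level) : Set (Level.suc (c ⊔ ℓ₁ ⊔ ℓ₂)) where
  field
    commutativeRing : CommutativeRing c ℓ₁
  open CommutativeRing commutativeRing public
  field
    _≤_         : Carrier → Carrier → Set ℓ₂
    isTotalOrder : IsTotalOrder _≈_ _≤_
    +-monoˡ-≤   : ∀ {a b} c → a ≤ b → (a + c) ≤ (b + c)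
    *-nonneg    : ∀ {a b} → 0# ≤ a → 0# ≤ b → 0# ≤ (a * b)

  _<_ : Carrier → Carrier → Set (ℓ₁ ⊔ ℓ₂)
  a < b = (a ≤ b) × ¬ (a ≈ b)

-- Finite simple graphs on vertex set Fin n (vertex v_i is index i-1).

record Graph (n : ℕ) : Set where
  field
    adj    : Fin n → Fin n → Bool
    sym    : ∀ i j → adj i j ≡ adj j i
    irrefl : ∀ i → adj i i ≡ false
open Graph public

record Subgraph {n : ℕ} (H : Graph n) : Set where
  field
    verts    : Subset n
    edges    : Fin n → Fin n → Bool
    e-sym    : ∀ i j → edges i j ≡ edges j i
    e-in-H   : ∀ i j → T (edges i j) → T (adj H i j)
    e-ends   : ∀ i j → T (edges i j) → (i ∈ verts) × (j ∈ verts)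
open Subgraph public

_∩G_ : ∀ {n} {H : Graph n} → Subgraph H → Subgraph H → Subgraph H
_∩G_ {H = H} J₁ J₂ = record
  { verts  = verts J₁ ∩ verts J₂
  ; edges  = λ i j → edges J₁ i j ∧ edges J₂ i j
  ; e-sym  = λ i j → cong₂ _∧_ (e-sym J₁ i j) (e-sym J₂ i j)
  ; e-in-H = λ i j t → e-in-H J₁ i j (proj₁ (Equivalence.to T-∧ t))
  ; e-ends = λ i j t →
      let t₁ = proj₁ (Equivalence.to T-∧ t)
          t₂ = proj₂ (Equivalence.to T-∧ t)
      in x∈p∩q⁺ (proj₁ (e-ends J₁ i j t₁) , proj₁ (e-ends J₂ i j t₂))
       , x∈p∩q⁺ (proj₂ (e-ends J₁ i j t₁) , proj₂ (e-ends J₂ i j t₂))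
  }

edgeCount : ∀ {n} {H : Graph n} → Subgraph H → ℕ
edgeCount {n} J =
  foldr (λ i k → foldr (λ j k' → (if does (i <? j) ∧ edges J i j then suc k' else k')) k (allFin n))
        0 (allFin n)

module _ {c ℓ₁ ℓ₂} (R : OrderedCommRing c ℓ₁ ℓ₂) where
  open OrderedCommRing R

  natMul : ℕ → Carrier → Carrier
  natMul zero    x = 0#
  natMul (suc n) x = x + natMul n x

  cost : ∀ {n} {H : Graph n} → (Fin n → Carrier) → Carrier →
         Fin n → Subgraph H → Carrier
  cost {n} w θ v J =
    foldr (λ u s → (if lookup (verts J) u ∧ not (does (u ≟ v)) then (1# + w u) else 0#) + s)
          0# (allFin n)
    - natMul (edgeCount J) θ

  IsMinimizer : ∀ {n} {H : Graph n} {ℓ} → (Fin n → Carrier) → Carrier →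
                (Subgraph H → Set ℓ) → Fin n → Subgraph H → Set _
  IsMinimizer {H = H} w θ allowed v J =
    allowed J × v ∈ verts J ×
    (∀ (J' : Subgraph H) → allowed J' → v ∈ verts J' → cost w θ v J ≤ cost w θ v J')

-- J ⊆ H \ {v_1,…,v_{k-1}}: all vertices of J have index ≥ index of v_k
Avoids : ∀ {n} {H : Graph n} → Fin n → Subgraph H → Set
Avoids {n} k J = ∀ (u : Fin n) → u ∈ verts J → toℕ k ℕ.≤ toℕ u

module Submission where

-- Write c_v(J) = Σ_{u ∈ V(J) ∖ {v}} (1 + w(u)) − e(J)·θ.  Two identities
-- about this cost carry the whole proof.
--   (1) Modularity: c_v(J ∪ K) + c_v(J ∩ K) = c_v(J) + c_v(K), because
--       vertices and edges are both counted by inclusion–exclusion.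
--   (2) Root exchange: if X and Y agree on containing v and on containing v′,
--       then c_v(X) + c_{v′}(Y) = c_v(Y) + c_{v′}(X).
-- Let Ĵ minimise c_{v₁}, let J̃ minimise c_{v_k} on H ∖ {v₁,…,v_{k−1}} and put
-- I = J̃ ∩ Ĵ.  Comparing Ĵ with J̃ ∪ Ĵ and using (1) gives
-- c_{v₁}(I) ≤ c_{v₁}(J̃).  Both I and J̃ contain v_k and (when k > 1) miss v₁,
-- so (2) turns this into c_{v_k}(I) ≤ c_{v_k}(J̃): I is a minimiser as well.
-- The second claim is the case k = 1.

open import Defs
open import Data.Nat using (ℕ; suc)
open import Data.Fin using (Fin; zero)
open import Data.Fin.Subset using (_∈_)
open import Data.Unit using (⊤)
open import Data.Product using (_×_)

import Data.Nat as ℕ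
import Data.Nat.Properties as ℕₚ
open import Algebra.Bundles using (CommutativeMonoid)
import Algebra.Properties.AbelianGroup as AbelianGroupProperties
import Algebra.Properties.CommutativeSemigroup as CommutativeSemigroupProperties
import Algebra.Properties.Group as GroupProperties
open import Data.Bool using (Bool; true; false; _∧_; _∨_; not; T; if_then_else_)
open import Data.Bool.Properties using (T-∨)
open import Data.Fin using (_<?_; _≟_)
open import Data.Fin.Subset using (_∪_)
open import Data.Fin.Subset.Properties using (x∈p∩q⁺; x∈p∩q⁻; x∈p∪q⁺)
open import Data.List using ([]; _∷_; foldr; allFin)
open import Data.Product using (_,_; proj₁) renaming (map to ×-map)
open import Data.Sum using (inj₁; inj₂; [_,_])
open import Data.Unit using (tt)
open import Data.Vec using (lookup)
open import Data.Vec.Properties using ([]=⇒lookup; lookup⇒[]=; lookup-zipWith)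
open import Function using (_∘_)
open import Function.Bundles using (Equivalence)
open import Relation.Binary.Bundles using (Poset)
open import Relation.Binary.PropositionalEquality as ≡ using (_≡_; cong; cong₂)
open import Relation.Binary.Structures using (IsTotalOrder)
open import Relation.Nullary using (does; yes; no)
import Relation.Binary.Reasoning.PartialOrder as PosetReasoning
import Relation.Binary.Reasoning.Setoid as SetoidReasoning

-- The union of two subgraphs: every vertex and every edge of either one.
-- It is the competitor against which the global minimiser Ĵ is compared.
_∪G_ : ∀ {n} {H : Graph n} → Subgraph H → Subgraph H → Subgraph H
J₁ ∪G J₂ = record
  { verts  = verts J₁ ∪ verts J₂
  ; edges  = λ i j → edges J₁ i j ∨ edges J₂ i j
  ; e-sym  = λ i j → cong₂ _∨_ (e-sym J₁ i j) (e-sym J₂ i j)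
  ; e-in-H = λ i j → [ e-in-H J₁ i j , e-in-H J₂ i j ] ∘ Equivalence.to T-∨
  ; e-ends = λ i j →
      [ ×-map (x∈p∪q⁺ ∘ inj₁) (x∈p∪q⁺ ∘ inj₁) ∘ e-ends J₁ i j
      , ×-map (x∈p∪q⁺ ∘ inj₂) (x∈p∪q⁺ ∘ inj₂) ∘ e-ends J₂ i j
      ] ∘ Equivalence.to T-∨
  }

-- Balanced quadruples p ∙ q ≈ r ∙ s in a commutative monoid.  Vertex sums
-- and edge counts are folds, and modularity/exchange are balance statements.
module Balance {c ℓ} (M : CommutativeMonoid c ℓ) where
  open CommutativeMonoid M
  open CommutativeSemigroupProperties commutativeSemigroup using (interchange)
  open SetoidReasoning setoid

  foldr-balance : ∀ {a} {A : Set a} (f₁ f₂ f₃ f₄ : A → Carrier → Carrier) →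
    (∀ x {p q r s} → p ∙ q ≈ r ∙ s → f₁ x p ∙ f₂ x q ≈ f₃ x r ∙ f₄ x s) →
    ∀ {p q r s} → p ∙ q ≈ r ∙ s → ∀ xs →
    foldr f₁ p xs ∙ foldr f₂ q xs ≈ foldr f₃ r xs ∙ foldr f₄ s xs
  foldr-balance f₁ f₂ f₃ f₄ step seed []       = seed
  foldr-balance f₁ f₂ f₃ f₄ step seed (x ∷ xs) =
    step x (foldr-balance f₁ f₂ f₃ f₄ step seed xs)

  sum-balance : ∀ {a} {A : Set a} (g₁ g₂ g₃ g₄ : A → Carrier) →
    (∀ x → g₁ x ∙ g₂ x ≈ g₃ x ∙ g₄ x) → ∀ xs →
    foldr (λ x t → g₁ x ∙ t) ε xs ∙ foldr (λ x t → g₂ x ∙ t) ε xs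
      ≈ foldr (λ x t → g₃ x ∙ t) ε xs ∙ foldr (λ x t → g₄ x ∙ t) ε xs
  sum-balance g₁ g₂ g₃ g₄ pointwise =
    foldr-balance (λ x t → g₁ x ∙ t) (λ x t → g₂ x ∙ t)
                  (λ x t → g₃ x ∙ t) (λ x t → g₄ x ∙ t) step refl
    where
    step : ∀ x {p q r s} → p ∙ q ≈ r ∙ s →
           (g₁ x ∙ p) ∙ (g₂ x ∙ q) ≈ (g₃ x ∙ r) ∙ (g₄ x ∙ s)
    step x {p} {q} {r} {s} seed = begin
      (g₁ x ∙ p) ∙ (g₂ x ∙ q)   ≈⟨ interchange _ _ _ _ ⟩
      (g₁ x ∙ g₂ x) ∙ (p ∙ q)   ≈⟨ ∙-cong (pointwise x) seed ⟩
      (g₃ x ∙ g₄ x) ∙ (r ∙ s)   ≈⟨ interchange _ _ _ _ ⟩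
      (g₃ x ∙ r) ∙ (g₄ x ∙ s)   ∎

module EdgeCount {n : ℕ} where
  open Balance ℕₚ.+-0-commutativeMonoid using (foldr-balance)

  pair-step : (Fin n → Fin n → Bool) → Fin n → Fin n → ℕ → ℕ
  pair-step e i j k = if does (i <? j) ∧ e i j then suc k else k

  row : (Fin n → Fin n → Bool) → Fin n → ℕ → ℕ
  row e i k = foldr (pair-step e i) k (allFin n)

  pair-balance : ∀ g x y {a b c d} → a ℕ.+ b ≡ c ℕ.+ d →
    (if g ∧ (x ∨ y) then suc a else a) ℕ.+ (if g ∧ (x ∧ y) then suc b else b)
      ≡ (if g ∧ x then suc c else c) ℕ.+ (if g ∧ y then suc d else d)
  pair-balance false x     y     eq = eq
  pair-balance true  false false eq = eq
  pair-balance true  true  false eq = cong suc eq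
  pair-balance true  false true  {c = c} {d} eq =
    ≡.trans (cong suc eq) (≡.sym (ℕₚ.+-suc c d))
  pair-balance true  true  true  {a} {b} {c} {d} eq =
    cong suc (≡.trans (ℕₚ.+-suc a b) (≡.trans (cong suc eq) (≡.sym (ℕₚ.+-suc c d))))

  edgeCount-modular : ∀ {H : Graph n} (J K : Subgraph H) →
    edgeCount (J ∪G K) ℕ.+ edgeCount (J ∩G K) ≡ edgeCount J ℕ.+ edgeCount K
  edgeCount-modular J K =
    foldr-balance (row (edges (J ∪G K))) (row (edges (J ∩G K)))
                  (row (edges J)) (row (edges K)) row-balance ≡.refl (allFin n)
    where
    row-balance : ∀ i {a b c d} → a ℕ.+ b ≡ c ℕ.+ d →
      row (edges (J ∪G K)) i a ℕ.+ row (edges (J ∩G K)) i b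
        ≡ row (edges J) i c ℕ.+ row (edges K) i d
    row-balance i seed =
      foldr-balance (pair-step (edges (J ∪G K)) i) (pair-step (edges (J ∩G K)) i)
                    (pair-step (edges J) i) (pair-step (edges K) i)
                    (λ j → pair-balance (does (i <? j)) (edges J i j) (edges K i j))
                    seed (allFin n)

module OrderedRing {c ℓ₁ ℓ₂} (R : OrderedCommRing c ℓ₁ ℓ₂) where
  open OrderedCommRing R hiding (zero) renaming (sym to ≈-sym)
  open AbelianGroupProperties +-abelianGroup using (⁻¹-∙-comm)
  open CommutativeSemigroupProperties +-commutativeSemigroup using (interchange)
  open GroupProperties +-group using (//-rightDividesʳ)

  poset : Poset c ℓ₁ ℓ₂
  poset = record { isPartialOrder = IsTotalOrder.isPartialOrder isTotalOrder }

  balance-≤ : ∀ {a b c d} → b + a ≈ c + d → c ≤ b → a ≤ d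
  balance-≤ {a} {b} {c} {d} balanced c≤b = begin
    a               ≈⟨ //-rightDividesʳ b a ⟨
    (a + b) - b     ≈⟨ +-cong (trans (+-comm a b) balanced) refl ⟩
    (c + d) - b     ≤⟨ +-monoˡ-≤ (- b) (+-monoˡ-≤ d c≤b) ⟩
    (b + d) - b     ≈⟨ +-cong (+-comm b d) refl ⟩
    (d + b) - b     ≈⟨ //-rightDividesʳ b d ⟩
    d               ∎
    where open PosetReasoning poset

  open SetoidReasoning setoid

  natMul-+ : ∀ m k x → natMul R (m ℕ.+ k) x ≈ natMul R m x + natMul R k x
  natMul-+ ℕ.zero    k x = ≈-sym (+-identityˡ _)
  natMul-+ (suc m) k x = trans (+-cong refl (natMul-+ m k x)) (≈-sym (+-assoc _ _ _))

  natMul-balance : ∀ {m₁ m₂ m₃ m₄} x → m₁ ℕ.+ m₂ ≡ m₃ ℕ.+ m₄ →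
    natMul R m₁ x + natMul R m₂ x ≈ natMul R m₃ x + natMul R m₄ x
  natMul-balance {m₁} {m₂} {m₃} {m₄} x eq = begin
    natMul R m₁ x + natMul R m₂ x   ≈⟨ natMul-+ m₁ m₂ x ⟨
    natMul R (m₁ ℕ.+ m₂) x          ≡⟨ cong (λ m → natMul R m x) eq ⟩
    natMul R (m₃ ℕ.+ m₄) x          ≈⟨ natMul-+ m₃ m₄ x ⟩
    natMul R m₃ x + natMul R m₄ x   ∎

  difference-balance : ∀ {a₁ a₂ a₃ a₄ b₁ b₂ b₃ b₄} →
    a₁ + a₂ ≈ a₃ + a₄ → b₁ + b₂ ≈ b₃ + b₄ →
    (a₁ - b₁) + (a₂ - b₂) ≈ (a₃ - b₃) + (a₄ - b₄)
  difference-balance {a₁} {a₂} {a₃} {a₄} {b₁} {b₂} {b₃} {b₄} ea eb = begin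
    (a₁ - b₁) + (a₂ - b₂)   ≈⟨ interchange a₁ (- b₁) a₂ (- b₂) ⟩
    (a₁ + a₂) + (- b₁ - b₂) ≈⟨ +-cong ea (trans (⁻¹-∙-comm b₁ b₂) (-‿cong eb)) ⟩
    (a₃ + a₄) - (b₃ + b₄)   ≈⟨ +-cong refl (⁻¹-∙-comm b₃ b₄) ⟨
    (a₃ + a₄) + (- b₃ - b₄) ≈⟨ interchange a₃ a₄ (- b₃) (- b₄) ⟩
    (a₃ - b₃) + (a₄ - b₄)   ∎

module Cost {c ℓ₁ ℓ₂} (R : OrderedCommRing c ℓ₁ ℓ₂) {n : ℕ} {H : Graph n}
            (w : Fin n → OrderedCommRing.Carrier R) (θ : OrderedCommRing.Carrier R) where
  open OrderedCommRing R using (Carrier; _≈_; _+_; 0#; 1#; refl; +-comm; +-commutativeMonoid)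
  open OrderedRing R using (natMul-balance; difference-balance)
  open Balance +-commutativeMonoid using (sum-balance)
  open EdgeCount using (edgeCount-modular)

  indicator : Carrier → Bool → Carrier
  indicator a b = if b then a else 0#

  weightAt : Fin n → Subgraph H → Fin n → Carrier
  weightAt v X u = indicator (1# + w u) (lookup (verts X) u ∧ not (does (u ≟ v)))

  cost-balance : ∀ (v₁ v₂ v₃ v₄ : Fin n) (X₁ X₂ X₃ X₄ : Subgraph H) →
    (∀ u → weightAt v₁ X₁ u + weightAt v₂ X₂ u ≈ weightAt v₃ X₃ u + weightAt v₄ X₄ u) →
    edgeCount X₁ ℕ.+ edgeCount X₂ ≡ edgeCount X₃ ℕ.+ edgeCount X₄ →
    cost R w θ v₁ X₁ + cost R w θ v₂ X₂ ≈ cost R w θ v₃ X₃ + cost R w θ v₄ X₄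
  cost-balance v₁ v₂ v₃ v₄ X₁ X₂ X₃ X₄ vertex-terms edge-counts =
    difference-balance
      (sum-balance (weightAt v₁ X₁) (weightAt v₂ X₂) (weightAt v₃ X₃) (weightAt v₄ X₄)
                   vertex-terms (allFin n))
      (natMul-balance {edgeCount X₁} {edgeCount X₂} {edgeCount X₃} {edgeCount X₄}
                      θ edge-counts)

  indicator-modular : ∀ a x y d →
    indicator a ((x ∨ y) ∧ d) + indicator a ((x ∧ y) ∧ d)
      ≈ indicator a (x ∧ d) + indicator a (y ∧ d)
  indicator-modular a true  true  d = refl
  indicator-modular a true  false d = refl
  indicator-modular a false true  d = +-comm _ _
  indicator-modular a false false d = refl

  indicator-exchange : ∀ a x y d d′ → (T d → x ≡ y) → (T d′ → x ≡ y) →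
    indicator a (x ∧ not d) + indicator a (y ∧ not d′)
      ≈ indicator a (y ∧ not d) + indicator a (x ∧ not d′)
  indicator-exchange a x y false false _ _ = +-comm _ _
  indicator-exchange a x y true  d′ agree _ with agree tt
  ... | ≡.refl = refl
  indicator-exchange a x y false true _ agree with agree tt
  ... | ≡.refl = refl

  cost-modular : ∀ v (J K : Subgraph H) →
    cost R w θ v (J ∪G K) + cost R w θ v (J ∩G K) ≈ cost R w θ v J + cost R w θ v K
  cost-modular v J K =
    cost-balance v v v v (J ∪G K) (J ∩G K) J K vertex-terms (edgeCount-modular J K)
    where
    vertex-terms : ∀ u → weightAt v (J ∪G K) u + weightAt v (J ∩G K) u
                           ≈ weightAt v J u + weightAt v K u
    vertex-terms u rewrite lookup-zipWith _∨_ u (verts J) (verts K)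
                         | lookup-zipWith _∧_ u (verts J) (verts K) =
      indicator-modular (1# + w u) (lookup (verts J) u) (lookup (verts K) u)
                        (not (does (u ≟ v)))

  cost-exchange : ∀ v v′ (X Y : Subgraph H) →
    lookup (verts X) v ≡ lookup (verts Y) v → lookup (verts X) v′ ≡ lookup (verts Y) v′ →
    cost R w θ v X + cost R w θ v′ Y ≈ cost R w θ v Y + cost R w θ v′ X
  cost-exchange v v′ X Y at-v at-v′ =
    cost-balance v v′ v v′ X Y Y X vertex-terms (ℕₚ.+-comm (edgeCount X) (edgeCount Y))
    where
    agree-at : ∀ {r} u → lookup (verts X) r ≡ lookup (verts Y) r →
               T (does (u ≟ r)) → lookup (verts X) u ≡ lookup (verts Y) u
    agree-at {r} u at-r _ with u ≟ r
    ... | yes ≡.refl = at-r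
    agree-at u at-r () | no _

    vertex-terms : ∀ u → weightAt v X u + weightAt v′ Y u ≈ weightAt v Y u + weightAt v′ X u
    vertex-terms u =
      indicator-exchange (1# + w u) (lookup (verts X) u) (lookup (verts Y) u)
                         (does (u ≟ v)) (does (u ≟ v′)) (agree-at u at-v) (agree-at u at-v′)

-- Two subgraphs of H ∖ {v₁,…,v_{k−1}} that contain v_k agree on whether they
-- contain v₁: for k = 1 both do, for k > 1 neither does.
avoiders-agree-at-v₁ : ∀ {h} {H : Graph (suc h)} k (X Y : Subgraph H) →
  Avoids k X → Avoids k Y → k ∈ verts X → k ∈ verts Y →
  lookup (verts X) zero ≡ lookup (verts Y) zero
avoiders-agree-at-v₁ zero    X Y _   _   k∈X k∈Y =
  ≡.trans ([]=⇒lookup k∈X) (≡.sym ([]=⇒lookup k∈Y))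
avoiders-agree-at-v₁ (Data.Fin.suc k) X Y avX avY _   _   =
  ≡.trans (misses-v₁ X avX) (≡.sym (misses-v₁ Y avY))
  where
  misses-v₁ : ∀ Z → Avoids (Data.Fin.suc k) Z → lookup (verts Z) zero ≡ false
  misses-v₁ Z avoids with lookup (verts Z) zero in eq
  ... | false = ≡.refl
  ... | true with avoids zero (lookup⇒[]= zero (verts Z) eq)
  ...   | ()

avoids-nothing : ∀ {n} {H : Graph (suc n)} (J : Subgraph H) → Avoids zero J
avoids-nothing J u _ = ℕ.z≤n

module Exchange {c ℓ₁ ℓ₂} (R : OrderedCommRing c ℓ₁ ℓ₂) {h : ℕ} (H : Graph (suc h))
                (w : Fin (suc h) → OrderedCommRing.Carrier R)
                (θ : OrderedCommRing.Carrier R) where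
  open OrderedCommRing R using (_≤_; isTotalOrder; trans; +-comm)
  open IsTotalOrder isTotalOrder using () renaming (trans to ≤-trans)
  open OrderedRing R using (balance-≤)
  open Cost R {H = H} w θ using (cost-modular; cost-exchange)

  C : Fin (suc h) → Subgraph H → OrderedCommRing.Carrier R
  C = cost R w θ

  intersection-minimiser : ∀ (Ĵ : Subgraph H) → IsMinimizer R w θ (λ _ → ⊤) zero Ĵ →
    ∀ (k : Fin (suc h)) → k ∈ verts Ĵ →
    ∀ (J̃ : Subgraph H) → IsMinimizer R w θ (Avoids k) k J̃ →
    IsMinimizer R w θ (Avoids k) k (J̃ ∩G Ĵ)
  intersection-minimiser Ĵ (_ , v₁∈Ĵ , Ĵ-min) k k∈Ĵ J̃ (J̃-avoids , k∈J̃ , J̃-min) =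
    I-avoids , k∈I , λ J avoids k∈J → ≤-trans I-beats-J̃ (J̃-min J avoids k∈J)
    where
    I = J̃ ∩G Ĵ

    I-avoids : Avoids k I
    I-avoids u u∈I = J̃-avoids u (proj₁ (x∈p∩q⁻ (verts J̃) (verts Ĵ) u∈I))

    k∈I : k ∈ verts I
    k∈I = x∈p∩q⁺ (k∈J̃ , k∈Ĵ)

    -- Modularity plus c_{v₁}(Ĵ) ≤ c_{v₁}(J̃ ∪ Ĵ).
    I-beats-J̃-at-v₁ : C zero I ≤ C zero J̃
    I-beats-J̃-at-v₁ =
      balance-≤ (trans (cost-modular zero J̃ Ĵ) (+-comm _ _))
                (Ĵ-min (J̃ ∪G Ĵ) tt (x∈p∪q⁺ (inj₂ v₁∈Ĵ)))

    -- Moving the root from v₁ to v_k shifts c(I) and c(J̃) equally.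
    I-beats-J̃ : C k I ≤ C k J̃
    I-beats-J̃ =
      balance-≤ (cost-exchange zero k J̃ I
                  (avoiders-agree-at-v₁ k J̃ I J̃-avoids I-avoids k∈J̃ k∈I)
                  (≡.trans ([]=⇒lookup k∈J̃) (≡.sym ([]=⇒lookup k∈I))))
                I-beats-J̃-at-v₁

  global-minimisers-intersect : ∀ (J′ J″ : Subgraph H) →
    IsMinimizer R w θ (λ _ → ⊤) zero J′ → IsMinimizer R w θ (λ _ → ⊤) zero J″ →
    IsMinimizer R w θ (λ _ → ⊤) zero (J′ ∩G J″)
  global-minimisers-intersect J′ J″ (_ , v₁∈J′ , J′-min) J″-minimiser@(_ , v₁∈J″ , _)
    with intersection-minimiser J″ J″-minimiser zero v₁∈J″ J′
           (avoids-nothing J′ , v₁∈J′ , λ J _ → J′-min J tt)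
  ... | _ , v₁∈I , I-min = tt , v₁∈I , λ J _ → I-min J (avoids-nothing J)

lemma25 : ∀ {c ℓ₁ ℓ₂} (R : OrderedCommRing c ℓ₁ ℓ₂) {h : ℕ} (H : Graph (suc h))
    (w : Fin (suc h) → OrderedCommRing.Carrier R) (θ : OrderedCommRing.Carrier R) →
    OrderedCommRing._<_ R (OrderedCommRing.0# R) θ →
    (∀ (Ĵ : Subgraph H) → IsMinimizer R w θ (λ _ → ⊤) zero Ĵ →
      ∀ (k : Fin (suc h)) → k ∈ verts Ĵ →
      ∀ (J̃ : Subgraph H) → IsMinimizer R w θ (Avoids k) k J̃ →
      IsMinimizer R w θ (Avoids k) k (J̃ ∩G Ĵ))
    × (∀ (J′ J″ : Subgraph H) → IsMinimizer R w θ (λ _ → ⊤) zero J′ →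
        IsMinimizer R w θ (λ _ → ⊤) zero J″ →
        IsMinimizer R w θ (λ _ → ⊤) zero (J′ ∩G J″))
lemma25 R H w θ _ = intersection-minimiser , global-minimisers-intersect
  where open Exchange R H w θ
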